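{- For any epistemic Heyting algebra $\mathbb{A}=(\mathbb{L},(\lozenge_i)_{i\in\mathsf{Ag}},(\Box_i)_{i\in\mathsf{Ag}})$ and any $a\in\mathbb{A}$, the pseudo-quotient algebra $\mathbb{A}^a$ is an epistemic Heyting algebra.
   Context: A monadic Heyting algebra is $\langle\mathbb{L},(\lozenge_i)_{i\in\mathsf{Ag}},(\Box_i)_{i\in\mathsf{Ag}}\rangle$ with $\mathbb{L}$ a Heyting algebra and monotone unary $\lozenge_i,\Box_i$ such that for all $a,b$: $a\le\lozenge_ia$; $\Box_ia\le a$; $\lozenge_i(a\vee b)\le\lozenge_ia\vee\lozenge_ib$; $\Box_i(a\to b)\le\Box_ia\to\Box_ib$; $\lozenge_ia\le\Box_i\lozenge_ia$; $\lozenge_i\Box_ia\le\Box_ia$; $\Box_i(a\to b)\le\lozenge_ia\to\lozenge_ib$; $\lozenge_i\bot\le\bot$; $\top\le\Box_i\top$. An epistemic Heyting algebra is a finite monadic Heyting algebra with $\lozenge_ia\vee\neg\lozenge_ia=\top$ for all $i,a$ ($\neg x:=x\to\bot$). The pseudo-quotient algebra is $\mathbb{A}^a=(\mathbb{L}/{\cong_a},(\lozenge^a_i),(\Box^a_i))$, where $b\cong_ac$ iff $b\wedge a=c\wedge a$ (a Heyting algebra congruence; $[c]$ denotes the class of $c$ and $\mathbb{L}/{\cong_a}$ carries the induced Heyting operations), $\lozenge^a_i[b]=[\lozenge_i(b\wedge a)]$ and $\Box^a_i[b]=[\Box_i(a\to b)]$. -}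

module Defs where

open import Level using (Level; _⊔_; suc)
open import Data.Nat using (ℕ)
open import Data.Fin using (Fin)
open import Data.Product using (Σ; ∃; _×_)
open import Relation.Binary.Core using (Rel)
open import Algebra.Core using (Op₁; Op₂)
open import Relation.Binary.Lattice.Structures using (IsHeytingAlgebra)

IsFinite : ∀ {c ℓ} {A : Set c} → Rel A ℓ → Set (c ⊔ ℓ)
IsFinite {A = A} _≈_ = Σ ℕ λ n → Σ (Fin n → A) λ f → ∀ x → ∃ λ i → f i ≈ x

record IsMonadicHeytingAlgebra {c ℓ₁ ℓ₂ ℓa} {A : Set c}
    (_≈_ : Rel A ℓ₁) (_≤_ : Rel A ℓ₂)
    (_∨_ _∧_ _⇨_ : Op₂ A) (⊤ ⊥ : A)
    (Ag : Set ℓa) (◇ □ : Ag → Op₁ A) : Set (c ⊔ ℓ₁ ⊔ ℓ₂ ⊔ ℓa) where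
  field
    isHeytingAlgebra : IsHeytingAlgebra _≈_ _≤_ _∨_ _∧_ _⇨_ ⊤ ⊥
    ◇-mono : ∀ i {x y} → x ≤ y → ◇ i x ≤ ◇ i y
    □-mono : ∀ i {x y} → x ≤ y → □ i x ≤ □ i y
    ◇-infl : ∀ i x → x ≤ ◇ i x
    □-defl : ∀ i x → □ i x ≤ x
    ◇-∨    : ∀ i x y → ◇ i (x ∨ y) ≤ (◇ i x ∨ ◇ i y)
    □-K    : ∀ i x y → □ i (x ⇨ y) ≤ (□ i x ⇨ □ i y)
    ◇□◇    : ∀ i x → ◇ i x ≤ □ i (◇ i x)
    ◇□□    : ∀ i x → ◇ i (□ i x) ≤ □ i x
    □◇K    : ∀ i x y → □ i (x ⇨ y) ≤ (◇ i x ⇨ ◇ i y)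
    ◇-⊥    : ∀ i → ◇ i ⊥ ≤ ⊥
    □-⊤    : ∀ i → ⊤ ≤ □ i ⊤

record IsEpistemicHeytingAlgebra {c ℓ₁ ℓ₂ ℓa} {A : Set c}
    (_≈_ : Rel A ℓ₁) (_≤_ : Rel A ℓ₂)
    (_∨_ _∧_ _⇨_ : Op₂ A) (⊤ ⊥ : A)
    (Ag : Set ℓa) (◇ □ : Ag → Op₁ A) : Set (c ⊔ ℓ₁ ⊔ ℓ₂ ⊔ ℓa) where
  field
    isMonadic : IsMonadicHeytingAlgebra _≈_ _≤_ _∨_ _∧_ _⇨_ ⊤ ⊥ Ag ◇ □
    finite    : IsFinite _≈_
    ◇-decided : ∀ i x → (◇ i x ∨ (◇ i x ⇨ ⊥)) ≈ ⊤

record EpistemicHeytingAlgebra {ℓa} (Ag : Set ℓa) c ℓ₁ ℓ₂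
    : Set (suc (c ⊔ ℓ₁ ⊔ ℓ₂) ⊔ ℓa) where
  infix  4 _≈_ _≤_
  infixr 5 _⇨_
  infixr 6 _∨_
  infixr 7 _∧_
  field
    Carrier : Set c
    _≈_     : Rel Carrier ℓ₁
    _≤_     : Rel Carrier ℓ₂
    _∨_     : Op₂ Carrier
    _∧_     : Op₂ Carrier
    _⇨_     : Op₂ Carrier
    ⊤       : Carrier
    ⊥       : Carrier
    ◇       : Ag → Op₁ Carrier
    □       : Ag → Op₁ Carrier
    isEpistemic : IsEpistemicHeytingAlgebra _≈_ _≤_ _∨_ _∧_ _⇨_ ⊤ ⊥ Ag ◇ □

-- The pseudo-quotient 𝔸ᵃ, presented as a setoid quotient: same carrier,
-- equality b ≅ₐ c iff b ∧ a ≈ c ∧ a, induced order [b] ≤ [c] iff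
-- b ∧ a ≤ c ∧ a, induced Heyting operations (computed on representatives),
-- ◇ᵃᵢ[b] = [◇ᵢ(b ∧ a)], □ᵃᵢ[b] = [□ᵢ(a ⇨ b)].
module PseudoQuotient {ℓa} {Ag : Set ℓa} {c ℓ₁ ℓ₂}
    (𝔸 : EpistemicHeytingAlgebra Ag c ℓ₁ ℓ₂) (a : EpistemicHeytingAlgebra.Carrier 𝔸) where
  open EpistemicHeytingAlgebra 𝔸

  _≅_ : Rel Carrier ℓ₁
  b ≅ c' = (b ∧ a) ≈ (c' ∧ a)

  _≤ᵃ_ : Rel Carrier ℓ₂
  b ≤ᵃ c' = (b ∧ a) ≤ (c' ∧ a)

  ◇ᵃ : Ag → Op₁ Carrier
  ◇ᵃ i b = ◇ i (b ∧ a)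

  □ᵃ : Ag → Op₁ Carrier
  □ᵃ i b = □ i (a ⇨ b)

  IsEpistemicPseudoQuotient : Set (c ⊔ ℓ₁ ⊔ ℓ₂ ⊔ ℓa)
  IsEpistemicPseudoQuotient =
    IsEpistemicHeytingAlgebra _≅_ _≤ᵃ_ _∨_ _∧_ _⇨_ ⊤ ⊥ Ag ◇ᵃ □ᵃ

-- The pseudo-quotient by a is the relativisation of 𝔸 to the principal
-- ideal ↓a: [b] ↦ b ∧ a identifies it with ↓a, and [b] ≤ [c] iff b ∧ a ≤ c,
-- so [x ⇨ y] is again an implication.  Every axiom of the relativised
-- operators ◇ᵢ(− ∧ a), □ᵢ(a ⇨ −) reduces to the corresponding axiom of 𝔸
-- precomposed with one of two Heyting inequalities (⇨-restrict, ⇨-K).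
-- Finiteness and the decidedness of ◇ pass to the quotient because it only
-- coarsens the equality.
module Submission where

open import Defs
open import Data.Product using (_,_)
open import Algebra.Core using (Op₁; Op₂)
open import Relation.Binary.Core using (Rel)
open import Relation.Binary.Structures using (IsEquivalence; IsPartialOrder)
open import Relation.Binary.Lattice.Bundles using (HeytingAlgebra)
open import Relation.Binary.Lattice.Structures using (IsHeytingAlgebra)
import Relation.Binary.Lattice.Properties.HeytingAlgebra as HeytingAlgebraProperties
import Relation.Binary.Lattice.Properties.DistributiveLattice as DistributiveLatticeProperties
import Relation.Binary.Lattice.Properties.MeetSemilattice as MeetSemilatticeProperties

isFinite-coarsen : ∀ {c ℓ ℓ′} {A : Set c} {_≈_ : Rel A ℓ} {_≈′_ : Rel A ℓ′} →
                   (∀ {x y} → x ≈ y → x ≈′ y) → IsFinite _≈_ → IsFinite _≈′_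
isFinite-coarsen ≈⇒≈′ (n , enum , onto) =
  n , enum , λ x → let i , enum-i≈x = onto x in i , ≈⇒≈′ enum-i≈x

module HeytingAlgebraLemmas {c ℓ₁ ℓ₂} (H : HeytingAlgebra c ℓ₁ ℓ₂) where
  open HeytingAlgebra H
  open HeytingAlgebraProperties H
  open MeetSemilatticeProperties meetSemilattice using (∧-monotonic)

  ∧-swapʳ-≤ : ∀ {x y z} → (x ∧ y) ∧ z ≤ (x ∧ z) ∧ y
  ∧-swapʳ-≤ = ∧-greatest (∧-monotonic (x∧y≤x _ _) refl)
                         (trans (x∧y≤x _ _) (x∧y≤y _ _))

  ⇨-K : ∀ {a x y} → a ⇨ (x ⇨ y) ≤ (a ⇨ x) ⇨ (a ⇨ y)
  ⇨-K {a} {x} {y} = transpose-⇨ (trans (⇨-distribˡ-∧-≥ a (x ⇨ y) x) (⇨ʳ-covariant ⇨-eval))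

  ⇨-restrict : ∀ {a x y} → a ⇨ (x ⇨ y) ≤ (x ∧ a) ⇨ (y ∧ a)
  ⇨-restrict = transpose-⇨ (∧-greatest (trans ≤x⇨y∧x ⇨-eval) (trans (x∧y≤y _ _) (x∧y≤y _ _)))
    where
    ≤x⇨y∧x : ∀ {a x y} → (a ⇨ (x ⇨ y)) ∧ (x ∧ a) ≤ (x ⇨ y) ∧ x
    ≤x⇨y∧x = ∧-greatest (trans (∧-monotonic refl (x∧y≤y _ _)) ⇨-eval)
                        (trans (x∧y≤y _ _) (x∧y≤x _ _))

module Relativisation {c ℓ₁ ℓ₂} (H : HeytingAlgebra c ℓ₁ ℓ₂) (a : HeytingAlgebra.Carrier H) where
  open HeytingAlgebra H
  open HeytingAlgebraProperties H
  open MeetSemilatticeProperties meetSemilattice using (∧-monotonic; ∧-cong)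
  open DistributiveLatticeProperties distributiveLattice using (∧-distribʳ-∨)
  open HeytingAlgebraLemmas H

  infix 4 _≅ᵃ_ _≤ᵃ_

  _≅ᵃ_ : Rel Carrier ℓ₁
  x ≅ᵃ y = x ∧ a ≈ y ∧ a

  _≤ᵃ_ : Rel Carrier ℓ₂
  x ≤ᵃ y = x ∧ a ≤ y ∧ a

  ≈⇒≅ᵃ : ∀ {x y} → x ≈ y → x ≅ᵃ y
  ≈⇒≅ᵃ x≈y = ∧-cong x≈y Eq.refl

  ≤⇒≤ᵃ : ∀ {x y} → x ≤ y → x ≤ᵃ y
  ≤⇒≤ᵃ x≤y = ∧-monotonic x≤y refl

  ≤ᵃ-intro : ∀ {x y} → x ∧ a ≤ y → x ≤ᵃ y
  ≤ᵃ-intro x∧a≤y = ∧-greatest x∧a≤y (x∧y≤y _ _)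

  ≤ᵃ-elim : ∀ {x y} → x ≤ᵃ y → x ∧ a ≤ y
  ≤ᵃ-elim x≤ᵃy = trans x≤ᵃy (x∧y≤x _ _)

  ≅ᵃ-isEquivalence : IsEquivalence _≅ᵃ_
  ≅ᵃ-isEquivalence = record { refl = Eq.refl ; sym = Eq.sym ; trans = Eq.trans }

  ≤ᵃ-isPartialOrder : IsPartialOrder _≅ᵃ_ _≤ᵃ_
  ≤ᵃ-isPartialOrder = record
    { isPreorder = record
      { isEquivalence = ≅ᵃ-isEquivalence
      ; reflexive     = reflexive
      ; trans         = trans
      }
    ; antisym = antisym
    }

  ≤ᵃ-exponential : ∀ {w x y} → (w ∧ x) ≤ᵃ y → w ≤ᵃ x ⇨ y
  ≤ᵃ-exponential w∧x≤ᵃy = ≤ᵃ-intro (transpose-⇨ (trans ∧-swapʳ-≤ (≤ᵃ-elim w∧x≤ᵃy)))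

  ≤ᵃ-evaluation : ∀ {w x y} → w ≤ᵃ x ⇨ y → (w ∧ x) ≤ᵃ y
  ≤ᵃ-evaluation w≤ᵃx⇨y = ≤ᵃ-intro (trans ∧-swapʳ-≤ (transpose-∧ (≤ᵃ-elim w≤ᵃx⇨y)))

  isHeytingAlgebraᵃ : IsHeytingAlgebra _≅ᵃ_ _≤ᵃ_ _∨_ _∧_ _⇨_ ⊤ ⊥
  isHeytingAlgebraᵃ = record
    { isBoundedLattice = record
      { isLattice = record
        { isPartialOrder = ≤ᵃ-isPartialOrder
        ; supremum = λ x y → ≤⇒≤ᵃ (x≤x∨y x y) , ≤⇒≤ᵃ (y≤x∨y x y) , λ z x≤ᵃz y≤ᵃz →
            trans (reflexive (∧-distribʳ-∨ a x y)) (∨-least x≤ᵃz y≤ᵃz)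
        ; infimum = λ x y → ≤⇒≤ᵃ (x∧y≤x x y) , ≤⇒≤ᵃ (x∧y≤y x y) , λ z z≤ᵃx z≤ᵃy →
            ≤ᵃ-intro (∧-greatest (≤ᵃ-elim z≤ᵃx) (≤ᵃ-elim z≤ᵃy))
        }
      ; maximum = λ x → ≤⇒≤ᵃ (maximum x)
      ; minimum = λ x → ≤⇒≤ᵃ (minimum x)
      }
    ; exponential = λ w x y → ≤ᵃ-exponential , ≤ᵃ-evaluation
    }

module MonadicRelativisation
    {c ℓ₁ ℓ₂ ℓa} {A : Set c} {_≈_ : Rel A ℓ₁} {_≤_ : Rel A ℓ₂}
    {_∨_ _∧_ _⇨_ : Op₂ A} {⊤ ⊥ : A} {Ag : Set ℓa} {◇ □ : Ag → Op₁ A}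
    (M : IsMonadicHeytingAlgebra _≈_ _≤_ _∨_ _∧_ _⇨_ ⊤ ⊥ Ag ◇ □) (a : A) where
  open IsMonadicHeytingAlgebra M

  heytingAlgebra : HeytingAlgebra c ℓ₁ ℓ₂
  heytingAlgebra = record { isHeytingAlgebra = isHeytingAlgebra }

  open HeytingAlgebra heytingAlgebra
    using (refl; reflexive; trans; x∧y≤x; transpose-⇨)
  open HeytingAlgebraProperties heytingAlgebra using (⇨-eval; ⇨-app; y≤x⇨y)
  open MeetSemilatticeProperties (HeytingAlgebra.meetSemilattice heytingAlgebra) using (∧-monotonic)
  open DistributiveLatticeProperties (HeytingAlgebraProperties.distributiveLattice heytingAlgebra)
    using (∧-distribʳ-∨)
  open HeytingAlgebraLemmas heytingAlgebra
  open Relativisation heytingAlgebra a public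

  ◇ᵃ : Ag → Op₁ A
  ◇ᵃ i x = ◇ i (x ∧ a)

  □ᵃ : Ag → Op₁ A
  □ᵃ i x = □ i (a ⇨ x)

  isMonadicHeytingAlgebra : IsMonadicHeytingAlgebra _≅ᵃ_ _≤ᵃ_ _∨_ _∧_ _⇨_ ⊤ ⊥ Ag ◇ᵃ □ᵃ
  isMonadicHeytingAlgebra = record
    { isHeytingAlgebra = isHeytingAlgebraᵃ
    ; ◇-mono = λ i x≤ᵃy → ≤⇒≤ᵃ (◇-mono i x≤ᵃy)
    ; □-mono = λ i x≤ᵃy → ≤⇒≤ᵃ (□-mono i (transpose-⇨ (trans (reflexive ⇨-app) (≤ᵃ-elim x≤ᵃy))))
    ; ◇-infl = λ i x → ≤ᵃ-intro (◇-infl i (x ∧ a))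
    ; □-defl = λ i x → ≤ᵃ-intro (trans (∧-monotonic (□-defl i (a ⇨ x)) refl) ⇨-eval)
    ; ◇-∨ = λ i x y → ≤⇒≤ᵃ (trans (◇-mono i (reflexive (∧-distribʳ-∨ a x y))) (◇-∨ i _ _))
    ; □-K = λ i x y → ≤⇒≤ᵃ (trans (□-mono i ⇨-K) (□-K i _ _))
    ; ◇□◇ = λ i x → ≤⇒≤ᵃ (trans (◇□◇ i (x ∧ a)) (□-mono i y≤x⇨y))
    ; ◇□□ = λ i x → ≤⇒≤ᵃ (trans (◇-mono i (x∧y≤x _ _)) (◇□□ i (a ⇨ x)))
    ; □◇K = λ i x y → ≤⇒≤ᵃ (trans (□-mono i ⇨-restrict) (□◇K i _ _))
    ; ◇-⊥ = λ i → ≤ᵃ-intro (trans (x∧y≤x _ _) (trans (◇-mono i (x∧y≤x _ _)) (◇-⊥ i)))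
    ; □-⊤ = λ i → ≤ᵃ-intro (trans (x∧y≤x _ _) (trans (□-⊤ i) (□-mono i y≤x⇨y)))
    }

proposition8 : ∀ {ℓa c ℓ₁ ℓ₂} {Ag : Set ℓa} (𝔸 : EpistemicHeytingAlgebra Ag c ℓ₁ ℓ₂) (a : EpistemicHeytingAlgebra.Carrier 𝔸)
    → PseudoQuotient.IsEpistemicPseudoQuotient 𝔸 a
proposition8 𝔸 a = record
  { isMonadic = isMonadicHeytingAlgebra
  ; finite    = isFinite-coarsen {_≈′_ = _≅ᵃ_} ≈⇒≅ᵃ finite
  ; ◇-decided = λ i x → ≈⇒≅ᵃ (◇-decided i (x ∧ a))
  }
  where
  open EpistemicHeytingAlgebra 𝔸 using (_∧_; isEpistemic)
  open IsEpistemicHeytingAlgebra isEpistemic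
  open MonadicRelativisation isMonadic a
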